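{- Let $M\in M_{n+1}(q)$ be a diagonalizable matrix having $t>2$ eigenspaces of dimensions $g_1\ge g_2\ge\dots\ge g_t$. Then one can construct a matrix $M'\in M_{n+1}(q)$ with $t-1$ eigenspaces of dimensions $g'_1\ge\dots\ge g'_{t-1}$ where $g'_1=g_1+g_2$ and $g'_i=g_{i+1}$ for $2\le i\le t-1$, such that $\nu_{M'}>\nu_M$.
   Context: $\nu_M$ denotes the number of eigenvectors (nonzero vectors $v$ with $Mv=\lambda v$, equivalently for left eigenvectors, for some $\lambda\in\mathbb F_q$) of $M$; for a diagonalizable matrix with eigenspaces of dimensions $g_1,\dots,g_t$ this is $\sum_i(q^{g_i}-1)$. -}

module Defs where

open import Level using (0ℓ)
open import Data.Nat using (ℕ; zero; suc; _+_; _≤_)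
open import Data.Fin using (Fin; toℕ)
open import Data.Fin.Properties using () renaming (_≟_ to _≟ᶠ_)
open import Data.Vec using (Vec; []; _∷_; lookup; map; replicate; zipWith; foldr; tabulate; transpose)
open import Data.Vec.Properties using (≡-dec)
open import Data.List using (List; length; filter; cartesianProductWith; allFin) renaming ([] to []ˡ; _∷_ to _∷ˡ_; map to mapˡ)
open import Data.List.Relation.Unary.Any using (Any)
open import Data.List.Relation.Unary.Any using (any?)
open import Data.Product using (Σ; ∃; ∃-syntax; _×_; _,_)
open import Data.Empty using (⊥)
open import Relation.Nullary using (¬_; Dec; yes; no; _×-dec_)
open import Relation.Nullary.Decidable using (map′; ¬?)
open import Relation.Binary.PropositionalEquality using (_≡_; _≢_; refl; sym; trans; cong)
open import Relation.Binary.Definitions using (DecidableEquality)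
open import Algebra.Structures using (IsCommutativeRing)
open import Function.Bundles using (_↔_; Inverse)

-- Equality is propositional
-- equality; the field axioms are those of a commutative ring together
-- with 0 ≠ 1 and existence of multiplicative inverses of nonzero elements.
-- `enum` is a bijection Fin q ↔ Carrier, i.e. the field has q elements.
record FiniteField (q : ℕ) : Set₁ where
  field
    Carrier : Set
    _+F_ _*F_ : Carrier → Carrier → Carrier
    -F_ : Carrier → Carrier
    0F 1F : Carrier
    isCommutativeRing : IsCommutativeRing _≡_ _+F_ _*F_ -F_ 0F 1F
    0≢1 : ¬ (0F ≡ 1F)
    inverse : ∀ x → ¬ (x ≡ 0F) → ∃[ y ] (x *F y ≡ 1F)
    enum : Fin q ↔ Carrier

module LinAlg {q : ℕ} (F : FiniteField q) where
  open FiniteField F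

  -- column vectors of length m and m×m matrices (list of rows)
  Vecₘ : ℕ → Set
  Vecₘ m = Vec Carrier m

  Mat : ℕ → Set
  Mat m = Vec (Vec Carrier m) m

  0v : ∀ {m} → Vecₘ m
  0v = replicate _ 0F

  _+v_ : ∀ {m} → Vecₘ m → Vecₘ m → Vecₘ m
  _+v_ = zipWith _+F_

  scale : ∀ {m} → Carrier → Vecₘ m → Vecₘ m
  scale c = map (c *F_)

  dot : ∀ {m} → Vecₘ m → Vecₘ m → Carrier
  dot u v = foldr _ _+F_ 0F (zipWith _*F_ u v)

  _·v_ : ∀ {m} → Mat m → Vecₘ m → Vecₘ m
  M ·v v = map (λ row → dot row v) M

  _⊗_ : ∀ {m} → Mat m → Mat m → Mat m
  A ⊗ B = map (λ row → map (λ col → dot row col) (transpose B)) A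

  identity : ∀ {m} → Mat m
  identity = tabulate λ i → tabulate λ j → δ i j
    where
    δ : ∀ {m} → Fin m → Fin m → Carrier
    δ i j with i ≟ᶠ j
    ... | yes _ = 1F
    ... | no  _ = 0F

  IsDiagonal : ∀ {m} → Mat m → Set
  IsDiagonal {m} D = ∀ (i j : Fin m) → i ≢ j → lookup (lookup D i) j ≡ 0F

  Diagonalizable : ∀ {m} → Mat m → Set
  Diagonalizable {m} M =
    Σ (Mat m) λ P → Σ (Mat m) λ Pinv → Σ (Mat m) λ D →
      (P ⊗ Pinv ≡ identity) × (Pinv ⊗ P ≡ identity) × IsDiagonal D × (M ≡ (P ⊗ D) ⊗ Pinv)

  Eigenspace : ∀ {m} → Mat m → Carrier → Vecₘ m → Set
  Eigenspace M λ' v = M ·v v ≡ scale λ' v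

  IsEigenvalue : ∀ {m} → Mat m → Carrier → Set
  IsEigenvalue {m} M λ' = Σ (Vecₘ m) λ v → (v ≢ 0v) × Eigenspace M λ' v

  lincomb : ∀ {m g} → Vec Carrier g → Vec (Vecₘ m) g → Vecₘ m
  lincomb c b = foldr _ _+v_ 0v (zipWith scale c b)

  LinearlyIndependent : ∀ {m g} → Vec (Vecₘ m) g → Set
  LinearlyIndependent {m} {g} b = ∀ (c : Vec Carrier g) → lincomb c b ≡ 0v → c ≡ replicate g 0F

  HasDimension : ∀ {m} → (Vecₘ m → Set) → ℕ → Set
  HasDimension {m} S g =
    Σ (Vec (Vecₘ m) g) λ b →
      (∀ i → S (lookup b i)) × LinearlyIndependent b ×
      (∀ v → S v → Σ (Vec Carrier g) λ c → v ≡ lincomb c b)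

  EigenspaceDims : ∀ {m t} → Mat m → Vec ℕ t → Set
  EigenspaceDims {m} {t} M g =
    Σ (Vec Carrier t) λ λs →
      (∀ i j → lookup λs i ≡ lookup λs j → i ≡ j) ×
      (∀ i → IsEigenvalue M (lookup λs i)) ×
      (∀ μ → IsEigenvalue M μ → ∃[ i ] (μ ≡ lookup λs i)) ×
      (∀ i → HasDimension (Eigenspace M (lookup λs i)) (lookup g i))

  elems : List Carrier
  elems = mapˡ (Inverse.to enum) (allFin q)

  _≟_ : DecidableEquality Carrier
  x ≟ y = map′ (λ e → trans (sym (Inverse.strictlyInverseˡ enum x))
                         (trans (cong (Inverse.to enum) e) (Inverse.strictlyInverseˡ enum y)))
               (cong (Inverse.from enum))
               (Inverse.from enum x ≟ᶠ Inverse.from enum y)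

  allVecs : ∀ m → List (Vecₘ m)
  allVecs zero = [] ∷ˡ []ˡ
  allVecs (suc m) = cartesianProductWith _∷_ elems (allVecs m)

  IsEigenvector : ∀ {m} → Mat m → Vecₘ m → Set
  IsEigenvector M v = (v ≢ 0v) × Any (λ μ → Eigenspace M μ v) elems

  isEigenvector? : ∀ {m} (M : Mat m) (v : Vecₘ m) → Dec (IsEigenvector M v)
  isEigenvector? M v = ¬? (≡-dec _≟_ v 0v) ×-dec any? (λ μ → ≡-dec _≟_ (M ·v v) (scale μ v)) elems

  ν : ∀ {m} → Mat m → ℕ
  ν {m} M = length (filter (isEigenvector? M) (allVecs m))

Descending : ∀ {t} → Vec ℕ t → Set
Descending {t} g = ∀ (i j : Fin t) → toℕ i ≤ toℕ j → lookup g j ≤ lookup g i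

mergeTop : ∀ {s} → Vec ℕ (suc (suc s)) → Vec ℕ (suc s)
mergeTop (a ∷ b ∷ r) = (a + b) ∷ r

{-# OPTIONS --safe #-}
-- Write M = P D P⁻¹ with D diagonal and let M′ = P D′ P⁻¹, where D′ is D with every diagonal entry
-- λ₂ replaced by λ₁.  In the coordinates x = P⁻¹ v both matrices act diagonally, so v is a
-- μ-eigenvector exactly when x vanishes off the positions where the diagonal equals μ.  Hence the
-- λ₁-eigenspace of M′ is the direct sum of the λ₁- and λ₂-eigenspaces of M, the other eigenspaces
-- are unchanged and λ₂ is no longer an eigenvalue.  Every eigenvector of M stays one of M′, while
-- u₁ + u₂ with nonzero uᵢ in the λᵢ-eigenspace of M is an eigenvector of M′ but not of M.
module Submission where

open import Defs
open import Level using (0ℓ)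
open import Algebra.Bundles using (CommutativeRing)
import Algebra.Properties.CommutativeSemigroup as CommutativeSemigroupProperties
import Algebra.Properties.Ring as RingProperties
open import Data.Nat using (ℕ; zero; suc; _+_; _≤_; _<_; z≤n; s≤s)
open import Data.Nat.Properties using (m≤n⇒m≤1+n)
open import Data.Fin using (Fin; zero; suc)
open import Data.Fin.Properties using (0≢1+n; suc-injective; ¬∀⟶∃¬) renaming (_≟_ to _≟ᶠ_)
open import Data.Vec using (Vec; []; _∷_; _++_; splitAt; lookup; map; replicate; tabulate; transpose; _⊛_)
open import Data.Vec.Properties
  using (lookup-map; lookup-zipWith; lookup-replicate; lookup∘tabulate; tabulate∘lookup; tabulate-cong;
         lookup-⊛; map-replicate; zipWith-identityˡ; zipWith-identityʳ; zipWith-assoc; zipWith-comm)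
import Data.Vec.Relation.Unary.All.Properties as All
open import Data.Product using (Σ; ∃; ∃₂; ∃-syntax; _×_; _,_; proj₁; proj₂)
open import Data.Sum using (_⊎_; inj₁; inj₂; map₂)
open import Data.Empty using (⊥-elim)
open import Function using (_∘_; _∋_)
open import Relation.Nullary using (¬_; Dec; yes; no; does)
open import Data.Bool using (if_then_else_)
open import Relation.Unary using (_⊆_; _≐_; Decidable)
open import Relation.Unary.Properties using (≐-sym)
open import Relation.Binary.PropositionalEquality
open import Data.List as List using (length; filter)
open import Data.List.Membership.Propositional using (_∈_; lose)
open import Data.List.Membership.Propositional.Properties using (∈-map⁺; ∈-allFin; ∈-cartesianProductWith⁺)
open import Data.List.Relation.Unary.Any using (here; there; satisfied)
open import Function.Bundles using (Inverse)

module _ {A : Set} {P Q : A → Set} (P? : Decidable P) (Q? : Decidable Q) (P⊆Q : P ⊆ Q) where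

  filter-length-mono : ∀ xs → length (filter P? xs) ≤ length (filter Q? xs)
  filter-length-mono List.[]         = z≤n
  filter-length-mono (y List.∷ ys) with P? y | Q? y
  ... | yes _  | yes _  = s≤s (filter-length-mono ys)
  ... | yes Py | no ¬Qy = ⊥-elim (¬Qy (P⊆Q Py))
  ... | no _   | yes _  = m≤n⇒m≤1+n (filter-length-mono ys)
  ... | no _   | no _   = filter-length-mono ys

  filter-length-< : ∀ {x xs} → x ∈ xs → Q x → ¬ P x → length (filter P? xs) < length (filter Q? xs)
  filter-length-< {xs = y List.∷ ys} (here refl) Qy ¬Py with P? y | Q? y
  ... | yes Py | _      = ⊥-elim (¬Py Py)
  ... | no _   | no ¬Qy = ⊥-elim (¬Qy Qy)
  ... | no _   | yes _  = s≤s (filter-length-mono ys)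
  filter-length-< {xs = y List.∷ ys} (there x∈ys) Qx ¬Px with P? y | Q? y
  ... | yes _  | yes _  = s≤s (filter-length-< x∈ys Qx ¬Px)
  ... | yes Py | no ¬Qy = ⊥-elim (¬Qy (P⊆Q Py))
  ... | no _   | yes _  = m≤n⇒m≤1+n (filter-length-< x∈ys Qx ¬Px)
  ... | no _   | no _   = filter-length-< x∈ys Qx ¬Px

lookup-ext : ∀ {A : Set} {n} {u v : Vec A n} → (∀ i → lookup u i ≡ lookup v i) → u ≡ v
lookup-ext {u = u} {v} u≗v = trans (sym (tabulate∘lookup u)) (trans (tabulate-cong u≗v) (tabulate∘lookup v))

lookup∘tabulate₂ : ∀ {A : Set} {m n} (f : Fin m → Fin n → A) i j →
                   lookup (lookup (tabulate λ a → tabulate (f a)) i) j ≡ f i j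
lookup∘tabulate₂ f i j = trans (cong (λ row → lookup row j) (lookup∘tabulate _ i)) (lookup∘tabulate (f i) j)

replicate-++ : ∀ {A : Set} g₁ g₂ (x : A) → replicate g₁ x ++ replicate g₂ x ≡ replicate (g₁ + g₂) x
replicate-++ zero     g₂ x = refl
replicate-++ (suc g₁) g₂ x = cong (x ∷_) (replicate-++ g₁ g₂ x)

Distinct : ∀ {A : Set} {s} → Vec A s → Set
Distinct xs = ∀ i j → lookup xs i ≡ lookup xs j → i ≡ j

Distinct-drop-second : ∀ {A : Set} {s} {x y : A} {xs : Vec A s} → Distinct (x ∷ y ∷ xs) → Distinct (x ∷ xs)
Distinct-drop-second distinct zero    zero    _  = refl
Distinct-drop-second distinct zero    (suc j) eq = ⊥-elim (0≢1+n (distinct zero (suc (suc j)) eq))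
Distinct-drop-second distinct (suc i) zero    eq = ⊥-elim (0≢1+n (distinct zero (suc (suc i)) (sym eq)))
Distinct-drop-second distinct (suc i) (suc j) eq = suc-injective (distinct (suc (suc i)) (suc (suc j)) eq)

module _ {q : ℕ} (F : FiniteField q) where
  open FiniteField F
  open LinAlg F

  commutativeRing : CommutativeRing 0ℓ 0ℓ
  commutativeRing = record { isCommutativeRing = isCommutativeRing }

  open CommutativeRing commutativeRing
    using (+-identityˡ; +-identityʳ; +-assoc; +-comm; *-identityˡ; *-identityʳ; *-assoc; *-comm;
           zeroˡ; zeroʳ; distribˡ; distribʳ; -‿inverseʳ; ring;
           +-commutativeSemigroup; *-commutativeSemigroup)
  open RingProperties ring using ([y-z]x≈yx-zx; x∙y⁻¹≈ε⇒x≈y)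
  open CommutativeSemigroupProperties +-commutativeSemigroup using (interchange)
  open CommutativeSemigroupProperties *-commutativeSemigroup using (x∙yz≈y∙xz)
  open ≡-Reasoning

  x*y≡0⇒y≡0 : ∀ {x y} → x ≢ 0F → x *F y ≡ 0F → y ≡ 0F
  x*y≡0⇒y≡0 {x} {y} x≢0 xy≡0 with inverse x x≢0
  ... | x⁻¹ , xx⁻¹≡1 = begin
    y                ≡⟨ sym (*-identityˡ y) ⟩
    1F *F y          ≡⟨ cong (_*F y) (trans (sym xx⁻¹≡1) (*-comm x x⁻¹)) ⟩
    (x⁻¹ *F x) *F y  ≡⟨ *-assoc x⁻¹ x y ⟩
    x⁻¹ *F (x *F y)  ≡⟨ cong (x⁻¹ *F_) xy≡0 ⟩
    x⁻¹ *F 0F        ≡⟨ zeroʳ x⁻¹ ⟩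
    0F               ∎

  *-cancelʳ-⊎ : ∀ a x y → x *F a ≡ y *F a → a ≡ 0F ⊎ x ≡ y
  *-cancelʳ-⊎ a x y xa≡ya with a ≟ 0F
  ... | yes a≡0 = inj₁ a≡0
  ... | no a≢0  = inj₂ (x∙y⁻¹≈ε⇒x≈y x y (x*y≡0⇒y≡0 a≢0 (begin
    a *F (x +F (-F y))           ≡⟨ *-comm a _ ⟩
    (x +F (-F y)) *F a           ≡⟨ [y-z]x≈yx-zx a x y ⟩
    (x *F a) +F (-F (y *F a))    ≡⟨ cong (λ z → z +F (-F (y *F a))) xa≡ya ⟩
    (y *F a) +F (-F (y *F a))    ≡⟨ -‿inverseʳ (y *F a) ⟩
    0F                           ∎)))

  *-congʳ-⊎ : ∀ {a x y} → a ≡ 0F ⊎ x ≡ y → x *F a ≡ y *F a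
  *-congʳ-⊎ {x = x} {y} (inj₁ refl) = trans (zeroʳ x) (sym (zeroʳ y))
  *-congʳ-⊎             (inj₂ refl) = refl

  lookup-0v : ∀ {m} i → lookup (0v {m}) i ≡ 0F
  lookup-0v i = lookup-replicate i 0F

  lookup-0⇒≡0v : ∀ {m} {u : Vecₘ m} → (∀ i → lookup u i ≡ 0F) → u ≡ 0v
  lookup-0⇒≡0v u≗0 = lookup-ext λ i → trans (u≗0 i) (sym (lookup-0v i))

  ≢0v⇒nonzero-entry : ∀ {m} {u : Vecₘ m} → u ≢ 0v → ∃ λ i → lookup u i ≢ 0F
  ≢0v⇒nonzero-entry {m} {u} u≢0 =
    ¬∀⟶∃¬ m (λ i → lookup u i ≡ 0F) (λ i → lookup u i ≟ 0F) (u≢0 ∘ lookup-0⇒≡0v)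

  lookup-+v : ∀ {m} (u v : Vecₘ m) i → lookup (u +v v) i ≡ lookup u i +F lookup v i
  lookup-+v u v i = lookup-zipWith _+F_ i u v

  lookup-scale : ∀ {m} c (u : Vecₘ m) i → lookup (scale c u) i ≡ c *F lookup u i
  lookup-scale c u i = lookup-map i (c *F_) u

  lookup-·v : ∀ {m} (A : Mat m) v i → lookup (A ·v v) i ≡ dot (lookup A i) v
  lookup-·v A v i = lookup-map i (λ row → dot row v) A

  +v-identityˡ : ∀ {m} (u : Vecₘ m) → 0v +v u ≡ u
  +v-identityˡ = zipWith-identityˡ +-identityˡ

  +v-identityʳ : ∀ {m} (u : Vecₘ m) → u +v 0v ≡ u
  +v-identityʳ = zipWith-identityʳ +-identityʳ

  +v-assoc : ∀ {m} (u v w : Vecₘ m) → (u +v v) +v w ≡ u +v (v +v w)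
  +v-assoc = zipWith-assoc +-assoc

  +v-comm : ∀ {m} (u v : Vecₘ m) → u +v v ≡ v +v u
  +v-comm = zipWith-comm +-comm

  scale-0v : ∀ {m} c → scale c (0v {m}) ≡ 0v
  scale-0v {m} c = trans (map-replicate (c *F_) 0F m) (cong (replicate m) (zeroʳ c))

  scale-+v : ∀ {m} c (u v : Vecₘ m) → scale c (u +v v) ≡ scale c u +v scale c v
  scale-+v c u v = lookup-ext λ i → begin
    lookup (scale c (u +v v)) i                ≡⟨ lookup-scale c (u +v v) i ⟩
    c *F lookup (u +v v) i                     ≡⟨ cong (c *F_) (lookup-+v u v i) ⟩
    c *F (lookup u i +F lookup v i)            ≡⟨ distribˡ c _ _ ⟩
    (c *F lookup u i) +F (c *F lookup v i)        ≡⟨ cong₂ _+F_ (lookup-scale c u i) (lookup-scale c v i) ⟨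
    lookup (scale c u) i +F lookup (scale c v) i  ≡⟨ lookup-+v (scale c u) (scale c v) i ⟨
    lookup (scale c u +v scale c v) i             ∎

  scale-comm : ∀ {m} c d (u : Vecₘ m) → scale c (scale d u) ≡ scale d (scale c u)
  scale-comm c d u = lookup-ext λ i → begin
    lookup (scale c (scale d u)) i   ≡⟨ lookup-scale c (scale d u) i ⟩
    c *F lookup (scale d u) i        ≡⟨ cong (c *F_) (lookup-scale d u i) ⟩
    c *F (d *F lookup u i)           ≡⟨ x∙yz≈y∙xz c d _ ⟩
    d *F (c *F lookup u i)           ≡⟨ cong (d *F_) (lookup-scale c u i) ⟨
    d *F lookup (scale c u) i        ≡⟨ lookup-scale d (scale c u) i ⟨
    lookup (scale d (scale c u)) i   ∎

  dot-0ˡ : ∀ {m} (v : Vecₘ m) → dot 0v v ≡ 0F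
  dot-0ˡ []      = refl
  dot-0ˡ (y ∷ v) = trans (cong₂ _+F_ (zeroˡ y) (dot-0ˡ v)) (+-identityˡ 0F)

  dot-0ʳ : ∀ {m} (u : Vecₘ m) → dot u 0v ≡ 0F
  dot-0ʳ []      = refl
  dot-0ʳ (x ∷ u) = trans (cong₂ _+F_ (zeroʳ x) (dot-0ʳ u)) (+-identityˡ 0F)

  dot-+ˡ : ∀ {m} (u u′ v : Vecₘ m) → dot (u +v u′) v ≡ dot u v +F dot u′ v
  dot-+ˡ []      []        []      = sym (+-identityˡ 0F)
  dot-+ˡ (x ∷ u) (x′ ∷ u′) (y ∷ v) =
    trans (cong₂ _+F_ (distribʳ y x x′) (dot-+ˡ u u′ v)) (interchange _ _ _ _)

  dot-+ʳ : ∀ {m} (u v v′ : Vecₘ m) → dot u (v +v v′) ≡ dot u v +F dot u v′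
  dot-+ʳ []      []      []        = sym (+-identityˡ 0F)
  dot-+ʳ (x ∷ u) (y ∷ v) (y′ ∷ v′) =
    trans (cong₂ _+F_ (distribˡ x y y′) (dot-+ʳ u v v′)) (interchange _ _ _ _)

  dot-scaleˡ : ∀ {m} c (u v : Vecₘ m) → dot (scale c u) v ≡ c *F dot u v
  dot-scaleˡ c []      []      = sym (zeroʳ c)
  dot-scaleˡ c (x ∷ u) (y ∷ v) =
    trans (cong₂ _+F_ (*-assoc c x y) (dot-scaleˡ c u v)) (sym (distribˡ c _ _))

  dot-scaleʳ : ∀ {m} c (u v : Vecₘ m) → dot u (scale c v) ≡ c *F dot u v
  dot-scaleʳ c []      []      = sym (zeroʳ c)
  dot-scaleʳ c (x ∷ u) (y ∷ v) =
    trans (cong₂ _+F_ (x∙yz≈y∙xz x c y) (dot-scaleʳ c u v)) (sym (distribˡ c _ _))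

  dot-single : ∀ {m} (u v : Vecₘ m) k → (∀ j → j ≢ k → lookup u j ≡ 0F) →
               dot u v ≡ lookup u k *F lookup v k
  dot-single (x ∷ u) (y ∷ v) zero u-off =
    trans (cong ((x *F y) +F_) (trans (cong (λ w → dot w v) u≡0) (dot-0ˡ v))) (+-identityʳ _)
    where
    u≡0 : u ≡ 0v
    u≡0 = lookup-0⇒≡0v λ j → u-off (suc j) (λ ())
  dot-single (x ∷ u) (y ∷ v) (suc k) u-off =
    trans (cong (_+F dot u v) (trans (cong (_*F y) (u-off zero (λ ()))) (zeroˡ y)))
          (trans (+-identityˡ _) (dot-single u v k λ j j≢k → u-off (suc j) (j≢k ∘ suc-injective)))

  ·v-+v : ∀ {m} (A : Mat m) u v → A ·v (u +v v) ≡ (A ·v u) +v (A ·v v)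
  ·v-+v A u v = lookup-ext λ i → begin
    lookup (A ·v (u +v v)) i                    ≡⟨ lookup-·v A (u +v v) i ⟩
    dot (lookup A i) (u +v v)                   ≡⟨ dot-+ʳ (lookup A i) u v ⟩
    dot (lookup A i) u +F dot (lookup A i) v    ≡⟨ cong₂ _+F_ (lookup-·v A u i) (lookup-·v A v i) ⟨
    lookup (A ·v u) i +F lookup (A ·v v) i      ≡⟨ lookup-+v (A ·v u) (A ·v v) i ⟨
    lookup ((A ·v u) +v (A ·v v)) i             ∎

  ·v-scale : ∀ {m} (A : Mat m) c u → A ·v (scale c u) ≡ scale c (A ·v u)
  ·v-scale A c u = lookup-ext λ i → begin
    lookup (A ·v scale c u) i      ≡⟨ lookup-·v A (scale c u) i ⟩
    dot (lookup A i) (scale c u)   ≡⟨ dot-scaleʳ c (lookup A i) u ⟩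
    c *F dot (lookup A i) u        ≡⟨ cong (c *F_) (lookup-·v A u i) ⟨
    c *F lookup (A ·v u) i         ≡⟨ lookup-scale c (A ·v u) i ⟨
    lookup (scale c (A ·v u)) i    ∎

  ·v-0v : ∀ {m} (A : Mat m) → A ·v 0v ≡ 0v
  ·v-0v A = lookup-ext λ i → trans (lookup-·v A 0v i) (trans (dot-0ʳ (lookup A i)) (sym (lookup-0v i)))

  lookup-transpose-∷ : ∀ {k n} (r : Vec Carrier n) (B : Vec (Vec Carrier n) k) j →
                       lookup (transpose (r ∷ B)) j ≡ lookup r j ∷ lookup (transpose B) j
  lookup-transpose-∷ {n = n} r B j = begin
    lookup ((replicate n _∷_ ⊛ r) ⊛ transpose B) j
      ≡⟨ lookup-⊛ j (replicate n _∷_ ⊛ r) (transpose B) ⟩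
    lookup (replicate n _∷_ ⊛ r) j (lookup (transpose B) j)
      ≡⟨ cong (λ f → f (lookup (transpose B) j)) (lookup-⊛ j (replicate n _∷_) r) ⟩
    lookup (replicate n _∷_) j (lookup r j) (lookup (transpose B) j)
      ≡⟨ cong (λ f → f (lookup r j) (lookup (transpose B) j)) (lookup-replicate j _∷_) ⟩
    lookup r j ∷ lookup (transpose B) j
      ∎

  dot-transpose : ∀ {k n} (a : Vec Carrier k) (B : Vec (Vec Carrier n) k) v →
                  dot (map (dot a) (transpose B)) v ≡ dot a (map (λ row → dot row v) B)
  dot-transpose {n = n} [] [] v = trans (cong (λ w → dot w v) (map-replicate (dot []) [] n)) (dot-0ˡ v)
  dot-transpose (x ∷ a) (r ∷ B) v = begin
    dot (map (dot (x ∷ a)) (transpose (r ∷ B))) v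
      ≡⟨ cong (λ w → dot w v) columns ⟩
    dot (scale x r +v map (dot a) (transpose B)) v
      ≡⟨ dot-+ˡ (scale x r) _ v ⟩
    dot (scale x r) v +F dot (map (dot a) (transpose B)) v
      ≡⟨ cong₂ _+F_ (dot-scaleˡ x r v) (dot-transpose a B v) ⟩
    (x *F dot r v) +F dot a (map (λ row → dot row v) B) ∎
    where
    columns : map (dot (x ∷ a)) (transpose (r ∷ B)) ≡ scale x r +v map (dot a) (transpose B)
    columns = lookup-ext λ j → begin
      lookup (map (dot (x ∷ a)) (transpose (r ∷ B))) j
        ≡⟨ lookup-map j _ (transpose (r ∷ B)) ⟩
      dot (x ∷ a) (lookup (transpose (r ∷ B)) j)
        ≡⟨ cong (dot (x ∷ a)) (lookup-transpose-∷ r B j) ⟩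
      (x *F lookup r j) +F dot a (lookup (transpose B) j)
        ≡⟨ cong₂ _+F_ (lookup-scale x r j) (lookup-map j _ (transpose B)) ⟨
      lookup (scale x r) j +F lookup (map (dot a) (transpose B)) j
        ≡⟨ lookup-+v (scale x r) _ j ⟨
      lookup (scale x r +v map (dot a) (transpose B)) j
        ∎

  ⊗-·v : ∀ {m} (A B : Mat m) v → (A ⊗ B) ·v v ≡ A ·v (B ·v v)
  ⊗-·v A B v = lookup-ext λ i → begin
    lookup ((A ⊗ B) ·v v) i                                 ≡⟨ lookup-·v (A ⊗ B) v i ⟩
    dot (lookup (A ⊗ B) i) v                                ≡⟨ cong (λ w → dot w v) (lookup-map i _ A) ⟩
    dot (map (dot (lookup A i)) (transpose B)) v            ≡⟨ dot-transpose (lookup A i) B v ⟩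
    dot (lookup A i) (B ·v v)                               ≡⟨ lookup-·v A (B ·v v) i ⟨
    lookup (A ·v (B ·v v)) i                                ∎

  diag : ∀ {m} → Mat m → Fin m → Carrier
  diag A k = lookup (lookup A k) k

  IsDiagonal⇒lookup-·v : ∀ {m} (D : Mat m) → IsDiagonal D → ∀ v k → lookup (D ·v v) k ≡ diag D k *F lookup v k
  IsDiagonal⇒lookup-·v D D-diagonal v k =
    trans (lookup-·v D v k) (dot-single (lookup D k) v k λ j j≢k → D-diagonal k j (j≢k ∘ sym))

  -- The entries of identity are computed by a helper local to its definition, which cannot be
  -- named; the ascription exposes it as the right-hand side, so that `with` can split on i ≟ᶠ j.
  identity-isDiagonal : ∀ {m} → IsDiagonal (identity {m})
  identity-isDiagonal {m} i j i≢j with (lookup (lookup (identity {m}) i) j ≡ _ ∋ lookup∘tabulate₂ _ i j)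
  ... | entry with i ≟ᶠ j
  ... | yes i≡j = ⊥-elim (i≢j i≡j)
  ... | no _    = entry

  diag-identity : ∀ {m} (k : Fin m) → diag identity k ≡ 1F
  diag-identity k with (diag identity k ≡ _ ∋ lookup∘tabulate₂ _ k k)
  ... | entry with k ≟ᶠ k
  ... | yes _   = entry
  ... | no k≢k  = ⊥-elim (k≢k refl)

  identity-·v : ∀ {m} (v : Vecₘ m) → identity ·v v ≡ v
  identity-·v v = lookup-ext λ k → begin
    lookup (identity ·v v) k        ≡⟨ IsDiagonal⇒lookup-·v identity identity-isDiagonal v k ⟩
    diag identity k *F lookup v k   ≡⟨ cong (_*F lookup v k) (diag-identity k) ⟩
    1F *F lookup v k                ≡⟨ *-identityˡ _ ⟩
    lookup v k                      ∎

  diagonal : ∀ {m} → (Fin m → Carrier) → Mat m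
  diagonal d = tabulate λ i → scale (d i) (lookup identity i)

  lookup-diagonal : ∀ {m} (d : Fin m → Carrier) i j →
                    lookup (lookup (diagonal d) i) j ≡ d i *F lookup (lookup identity i) j
  lookup-diagonal d i j =
    trans (cong (λ row → lookup row j) (lookup∘tabulate _ i)) (lookup-scale (d i) (lookup identity i) j)

  diagonal-isDiagonal : ∀ {m} (d : Fin m → Carrier) → IsDiagonal (diagonal d)
  diagonal-isDiagonal d i j i≢j =
    trans (lookup-diagonal d i j) (trans (cong (d i *F_) (identity-isDiagonal i j i≢j)) (zeroʳ (d i)))

  diag-diagonal : ∀ {m} (d : Fin m → Carrier) k → diag (diagonal d) k ≡ d k
  diag-diagonal d k = trans (lookup-diagonal d k k) (trans (cong (d k *F_) (diag-identity k)) (*-identityʳ (d k)))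

  record IsSubspace {m} (S : Vecₘ m → Set) : Set where
    field
      0v-closed    : S 0v
      +v-closed    : ∀ {u v} → S u → S v → S (u +v v)
      scale-closed : ∀ c {u} → S u → S (scale c u)

  open IsSubspace

  Eigenspace-isSubspace : ∀ {m} (A : Mat m) μ → IsSubspace (Eigenspace A μ)
  Eigenspace-isSubspace A μ = record
    { 0v-closed    = trans (·v-0v A) (sym (scale-0v μ))
    ; +v-closed    = λ {u} {v} Au≡μu Av≡μv →
        trans (·v-+v A u v) (trans (cong₂ _+v_ Au≡μu Av≡μv) (sym (scale-+v μ u v)))
    ; scale-closed = λ c {u} Au≡μu →
        trans (·v-scale A c u) (trans (cong (scale c) Au≡μu) (scale-comm c μ u))
    }

  lincomb-closed : ∀ {m g} {S : Vecₘ m → Set} → IsSubspace S →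
                   (b : Vec (Vecₘ m) g) → (∀ i → S (lookup b i)) → ∀ c → S (lincomb c b)
  lincomb-closed S-sub []       b∈S []       = 0v-closed S-sub
  lincomb-closed S-sub (b ∷ bs) b∈S (c ∷ cs) =
    +v-closed S-sub (scale-closed S-sub c (b∈S zero)) (lincomb-closed S-sub bs (b∈S ∘ suc) cs)

  lincomb-++ : ∀ {m g₁ g₂} (c₁ : Vec Carrier g₁) (c₂ : Vec Carrier g₂)
               (b₁ : Vec (Vecₘ m) g₁) (b₂ : Vec (Vecₘ m) g₂) →
               lincomb (c₁ ++ c₂) (b₁ ++ b₂) ≡ lincomb c₁ b₁ +v lincomb c₂ b₂
  lincomb-++ []       c₂ []       b₂ = sym (+v-identityˡ _)
  lincomb-++ (c ∷ c₁) c₂ (b ∷ b₁) b₂ =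
    trans (cong (scale c b +v_) (lincomb-++ c₁ c₂ b₁ b₂)) (sym (+v-assoc _ _ _))

  _+ₛ_ : ∀ {m} → (Vecₘ m → Set) → (Vecₘ m → Set) → Vecₘ m → Set
  (S₁ +ₛ S₂) v = ∃₂ λ u₁ u₂ → S₁ u₁ × S₂ u₂ × v ≡ u₁ +v u₂

  +ₛ-inˡ : ∀ {m} {S₁ S₂ : Vecₘ m → Set} → IsSubspace S₂ → S₁ ⊆ S₁ +ₛ S₂
  +ₛ-inˡ S₂-sub {u} u∈S₁ = u , 0v , u∈S₁ , 0v-closed S₂-sub , sym (+v-identityʳ u)

  +ₛ-inʳ : ∀ {m} {S₁ S₂ : Vecₘ m → Set} → IsSubspace S₁ → S₂ ⊆ S₁ +ₛ S₂
  +ₛ-inʳ S₁-sub {u} u∈S₂ = 0v , u , 0v-closed S₁-sub , u∈S₂ , sym (+v-identityˡ u)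

  Independent : ∀ {m} → (Vecₘ m → Set) → (Vecₘ m → Set) → Set
  Independent S₁ S₂ = ∀ {u₁ u₂} → S₁ u₁ → S₂ u₂ → u₁ +v u₂ ≡ 0v → u₁ ≡ 0v × u₂ ≡ 0v

  HasDimension-+ₛ : ∀ {m g₁ g₂} {S₁ S₂ : Vecₘ m → Set} →
                    IsSubspace S₁ → IsSubspace S₂ → Independent S₁ S₂ →
                    HasDimension S₁ g₁ → HasDimension S₂ g₂ → HasDimension (S₁ +ₛ S₂) (g₁ + g₂)
  HasDimension-+ₛ {g₁ = g₁} {g₂} {S₁} {S₂} S₁-sub S₂-sub S₁⊥S₂
                  (b₁ , b₁∈S₁ , b₁-independent , b₁-spans)
                  (b₂ , b₂∈S₂ , b₂-independent , b₂-spans) =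
    b₁ ++ b₂ , members , independent , spans
    where
    members : ∀ i → (S₁ +ₛ S₂) (lookup (b₁ ++ b₂) i)
    members = All.lookup⁺ {P = S₁ +ₛ S₂}
      (All.++⁺ {xs = b₁} (All.lookup⁻ (+ₛ-inˡ S₂-sub ∘ b₁∈S₁)) (All.lookup⁻ {xs = b₂} (+ₛ-inʳ S₁-sub ∘ b₂∈S₂)))

    independent : LinearlyIndependent (b₁ ++ b₂)
    independent c c·b≡0 with splitAt g₁ c
    ... | c₁ , c₂ , refl
      with S₁⊥S₂ (lincomb-closed S₁-sub b₁ b₁∈S₁ c₁) (lincomb-closed S₂-sub b₂ b₂∈S₂ c₂)
                 (trans (sym (lincomb-++ c₁ c₂ b₁ b₂)) c·b≡0)
    ... | u₁≡0 , u₂≡0 =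
      trans (cong₂ _++_ (b₁-independent c₁ u₁≡0) (b₂-independent c₂ u₂≡0)) (replicate-++ g₁ g₂ 0F)

    spans : ∀ v → (S₁ +ₛ S₂) v → Σ (Vec Carrier (g₁ + g₂)) λ c → v ≡ lincomb c (b₁ ++ b₂)
    spans _ (u₁ , u₂ , u₁∈S₁ , u₂∈S₂ , refl) with b₁-spans u₁ u₁∈S₁ | b₂-spans u₂ u₂∈S₂
    ... | c₁ , refl | c₂ , refl = c₁ ++ c₂ , sym (lincomb-++ c₁ c₂ b₁ b₂)

  HasDimension-resp : ∀ {m g} {S T : Vecₘ m → Set} → S ≐ T → HasDimension S g → HasDimension T g
  HasDimension-resp (S⊆T , T⊆S) (b , b∈S , b-independent , b-spans) =
    b , S⊆T ∘ b∈S , b-independent , λ v v∈T → b-spans v (T⊆S v∈T)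

  Supported : ∀ {m} → (Fin m → Carrier) → Carrier → Vecₘ m → Set
  Supported d μ x = ∀ k → lookup x k ≡ 0F ⊎ d k ≡ μ

  Supported-cong : ∀ {m} {d e : Fin m → Carrier} {μ} → (∀ k → d k ≡ e k) → Supported d μ ⊆ Supported e μ
  Supported-cong d≗e x∈S k = map₂ (trans (sym (d≗e k))) (x∈S k)

  Eigenspace-isDiagonal : ∀ {m} (D : Mat m) → IsDiagonal D → ∀ μ → Eigenspace D μ ≐ Supported (diag D) μ
  Eigenspace-isDiagonal D D-diagonal μ = to , from
    where
    to : Eigenspace D μ ⊆ Supported (diag D) μ
    to {x} Dx≡μx k = *-cancelʳ-⊎ (lookup x k) (diag D k) μ (begin
      diag D k *F lookup x k   ≡⟨ IsDiagonal⇒lookup-·v D D-diagonal x k ⟨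
      lookup (D ·v x) k        ≡⟨ cong (λ v → lookup v k) Dx≡μx ⟩
      lookup (scale μ x) k     ≡⟨ lookup-scale μ x k ⟩
      μ *F lookup x k          ∎)

    from : Supported (diag D) μ ⊆ Eigenspace D μ
    from {x} x∈S = lookup-ext λ k → begin
      lookup (D ·v x) k        ≡⟨ IsDiagonal⇒lookup-·v D D-diagonal x k ⟩
      diag D k *F lookup x k   ≡⟨ *-congʳ-⊎ (x∈S k) ⟩
      μ *F lookup x k          ≡⟨ lookup-scale μ x k ⟨
      lookup (scale μ x) k     ∎

  Eigenspace-diagonal : ∀ {m} (d : Fin m → Carrier) μ → Eigenspace (diagonal d) μ ≐ Supported d μ
  Eigenspace-diagonal d μ with Eigenspace-isDiagonal (diagonal d) (diagonal-isDiagonal d) μ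
  ... | to , from = (λ {x} x∈E → Supported-cong (diag-diagonal d) {x} (to x∈E)) ,
                    (λ {x} x∈S → from (Supported-cong (sym ∘ diag-diagonal d) {x} x∈S))

  Supported-map : ∀ {m} {d : Fin m → Carrier} f {μ} → Supported d μ ⊆ Supported (f ∘ d) (f μ)
  Supported-map f x∈S k = map₂ (cong f) (x∈S k)

  Supported-reflect : ∀ {m} {d : Fin m → Carrier} {f : Carrier → Carrier} {μ} →
                      (∀ a → f a ≡ μ → a ≡ μ) → Supported (f ∘ d) μ ⊆ Supported d μ
  Supported-reflect f-reflects x∈S k = map₂ (f-reflects _) (x∈S k)

  Supported-≢⇒≡0v : ∀ {m} {d : Fin m → Carrier} {μ x} → (∀ k → d k ≢ μ) → Supported d μ x → x ≡ 0v
  Supported-≢⇒≡0v {d = d} {μ} {x} d≢μ x∈S = lookup-0⇒≡0v λ k → vanishes k (x∈S k)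
    where
    vanishes : ∀ k → lookup x k ≡ 0F ⊎ d k ≡ μ → lookup x k ≡ 0F
    vanishes k (inj₁ xₖ≡0) = xₖ≡0
    vanishes k (inj₂ dₖ≡μ) = ⊥-elim (d≢μ k dₖ≡μ)

  Supported-independent : ∀ {m} {d : Fin m → Carrier} {a b} → a ≢ b →
                          Independent (Supported d a) (Supported d b)
  Supported-independent {d = d} {a} {b} a≢b {x} {y} x∈Sa y∈Sb x+y≡0 =
    lookup-0⇒≡0v (proj₁ ∘ entries) , lookup-0⇒≡0v (proj₂ ∘ entries)
    where
    sum≡0 : ∀ k → lookup x k +F lookup y k ≡ 0F
    sum≡0 k = trans (sym (lookup-+v x y k)) (trans (cong (λ v → lookup v k) x+y≡0) (lookup-0v k))

    entries : ∀ k → lookup x k ≡ 0F × lookup y k ≡ 0F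
    entries k with x∈Sa k | y∈Sb k
    ... | inj₁ xₖ≡0 | _ =
      xₖ≡0 , trans (sym (+-identityˡ _)) (trans (cong (_+F lookup y k) (sym xₖ≡0)) (sum≡0 k))
    ... | inj₂ _ | inj₁ yₖ≡0 =
      trans (sym (+-identityʳ _)) (trans (cong (lookup x k +F_) (sym yₖ≡0)) (sum≡0 k)) , yₖ≡0
    ... | inj₂ dₖ≡a | inj₂ dₖ≡b = ⊥-elim (a≢b (trans (sym dₖ≡a) dₖ≡b))

  -- A nonzero entry of x is an entry of x + y, which pins μ to the value of d there.
  Supported-+v⇒≡ : ∀ {m} {d : Fin m → Carrier} {a b μ x y} → a ≢ b → Supported d a x → Supported d b y →
                 x ≢ 0v → Supported d μ (x +v y) → μ ≡ a
  Supported-+v⇒≡ {d = d} {x = x} {y} a≢b x∈Sa y∈Sb x≢0 x+y∈Sμ with ≢0v⇒nonzero-entry x≢0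
  ... | k , xₖ≢0 with x∈Sa k | y∈Sb k | x+y∈Sμ k
  ... | inj₁ xₖ≡0 | _         | _         = ⊥-elim (xₖ≢0 xₖ≡0)
  ... | inj₂ dₖ≡a | inj₂ dₖ≡b | _         = ⊥-elim (a≢b (trans (sym dₖ≡a) dₖ≡b))
  ... | inj₂ dₖ≡a | inj₁ _    | inj₂ dₖ≡μ = trans (sym dₖ≡μ) dₖ≡a
  ... | inj₂ _    | inj₁ yₖ≡0 | inj₁ sum≡0 = ⊥-elim (xₖ≢0 (begin
    lookup x k                   ≡⟨ +-identityʳ _ ⟨
    lookup x k +F 0F             ≡⟨ cong (lookup x k +F_) yₖ≡0 ⟨
    lookup x k +F lookup y k     ≡⟨ lookup-+v x y k ⟨
    lookup (x +v y) k            ≡⟨ sum≡0 ⟩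
    0F                           ∎))

  replace : Carrier → Carrier → Carrier → Carrier
  replace a b x = if does (x ≟ a) then b else x

  replace-cases : ∀ a b x → (x ≡ a × replace a b x ≡ b) ⊎ (x ≢ a × replace a b x ≡ x)
  replace-cases a b x = cases (x ≟ a)
    where
    cases : (x≟a : Dec (x ≡ a)) →
            (x ≡ a × (if does x≟a then b else x) ≡ b) ⊎ (x ≢ a × (if does x≟a then b else x) ≡ x)
    cases (yes x≡a) = inj₁ (x≡a , refl)
    cases (no x≢a)  = inj₂ (x≢a , refl)

  replace-target : ∀ a b → replace a b a ≡ b
  replace-target a b with replace-cases a b a
  ... | inj₁ (_ , r≡b)  = r≡b
  ... | inj₂ (a≢a , _)  = ⊥-elim (a≢a refl)

  replace-fixed : ∀ {a} b {x} → x ≢ a → replace a b x ≡ x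
  replace-fixed {a} b {x} x≢a with replace-cases a b x
  ... | inj₁ (x≡a , _) = ⊥-elim (x≢a x≡a)
  ... | inj₂ (_ , r≡x) = r≡x

  replace-reflects : ∀ {a b μ} → μ ≢ b → ∀ x → replace a b x ≡ μ → x ≡ μ
  replace-reflects {a} {b} μ≢b x r≡μ with replace-cases a b x
  ... | inj₁ (_ , r≡b) = ⊥-elim (μ≢b (trans (sym r≡μ) r≡b))
  ... | inj₂ (_ , r≡x) = trans (sym r≡x) r≡μ

  replace-≢ : ∀ {a b} → b ≢ a → ∀ x → replace a b x ≢ a
  replace-≢ {a} {b} b≢a x r≡a with replace-cases a b x
  ... | inj₁ (_ , r≡b)   = b≢a (trans (sym r≡b) r≡a)
  ... | inj₂ (x≢a , r≡x) = x≢a (trans (sym r≡x) r≡a)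

  onLevel offLevel : ∀ {m} → (Fin m → Carrier) → Carrier → Vecₘ m → Vecₘ m
  onLevel  d b x = tabulate λ k → if does (d k ≟ b) then lookup x k else 0F
  offLevel d b x = tabulate λ k → if does (d k ≟ b) then 0F else lookup x k

  offLevel-+v-onLevel : ∀ {m} (d : Fin m → Carrier) b x → offLevel d b x +v onLevel d b x ≡ x
  offLevel-+v-onLevel d b x = lookup-ext λ k → begin
    lookup (offLevel d b x +v onLevel d b x) k
      ≡⟨ lookup-+v (offLevel d b x) (onLevel d b x) k ⟩
    lookup (offLevel d b x) k +F lookup (onLevel d b x) k
      ≡⟨ cong₂ _+F_ (lookup∘tabulate _ k) (lookup∘tabulate _ k) ⟩
    (if does (d k ≟ b) then 0F else lookup x k) +F (if does (d k ≟ b) then lookup x k else 0F)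
      ≡⟨ entries (d k ≟ b) ⟩
    lookup x k ∎
    where
    entries : ∀ {P : Set} {v} (P? : Dec P) → (if does P? then 0F else v) +F (if does P? then v else 0F) ≡ v
    entries (yes _) = +-identityˡ _
    entries (no _)  = +-identityʳ _

  onLevel-supported : ∀ {m} (d : Fin m → Carrier) b x → Supported d b (onLevel d b x)
  onLevel-supported d b x k = subst (λ v → v ≡ 0F ⊎ d k ≡ b) (sym (lookup∘tabulate _ k)) (entry (d k ≟ b))
    where
    entry : (dₖ≟b : Dec (d k ≡ b)) → (if does dₖ≟b then lookup x k else 0F) ≡ 0F ⊎ d k ≡ b
    entry (yes dₖ≡b) = inj₂ dₖ≡b
    entry (no _)     = inj₁ refl

  offLevel-supported : ∀ {m} (d : Fin m → Carrier) {a b x} →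
                       Supported (replace b a ∘ d) a x → Supported d a (offLevel d b x)
  offLevel-supported d {a} {b} {x} x∈S k =
    subst (λ v → v ≡ 0F ⊎ d k ≡ a) (sym (lookup∘tabulate _ k)) (entry (d k ≟ b))
    where
    entry : (dₖ≟b : Dec (d k ≡ b)) → (if does dₖ≟b then 0F else lookup x k) ≡ 0F ⊎ d k ≡ a
    entry (yes _)   = inj₁ refl
    entry (no dₖ≢b) = map₂ (trans (sym (replace-fixed a dₖ≢b))) (x∈S k)

  Supported-replace : ∀ {m} {d : Fin m → Carrier} {a b} →
                      Supported (replace b a ∘ d) a ⊆ Supported d a +ₛ Supported d b
  Supported-replace {d = d} {a} {b} {x} x∈S =
    offLevel d b x , onLevel d b x , offLevel-supported d {x = x} x∈S , onLevel-supported d b x ,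
    sym (offLevel-+v-onLevel d b x)

  ∈-elems : ∀ x → x ∈ elems
  ∈-elems x = subst (_∈ elems) (Inverse.strictlyInverseˡ enum x)
                    (∈-map⁺ (Inverse.to enum) (∈-allFin (Inverse.from enum x)))

  ∈-allVecs : ∀ {m} (v : Vecₘ m) → v ∈ allVecs m
  ∈-allVecs []      = here refl
  ∈-allVecs (x ∷ v) = ∈-cartesianProductWith⁺ _∷_ (∈-elems x) (∈-allVecs v)

  IsEigenvector-intro : ∀ {m} {A : Mat m} {μ v} → v ≢ 0v → Eigenspace A μ v → IsEigenvector A v
  IsEigenvector-intro v≢0 v∈E = v≢0 , lose (∈-elems _) v∈E

  IsEigenvector-elim : ∀ {m} {A : Mat m} {v} → IsEigenvector A v → ∃ λ μ → Eigenspace A μ v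
  IsEigenvector-elim (_ , v∈E) = satisfied v∈E

  ·v-inverse : ∀ {m} {A B : Mat m} → A ⊗ B ≡ identity → ∀ v → A ·v (B ·v v) ≡ v
  ·v-inverse {A = A} {B} AB≡I v = trans (sym (⊗-·v A B v)) (trans (cong (_·v v) AB≡I) (identity-·v v))

  module Diagonalized {m} {P P⁻¹ D : Mat m} (PP⁻¹≡I : P ⊗ P⁻¹ ≡ identity) (P⁻¹P≡I : P⁻¹ ⊗ P ≡ identity)
                      (D-diagonal : IsDiagonal D) where

    M : Mat m
    M = (P ⊗ D) ⊗ P⁻¹

    relabel : (Carrier → Carrier) → Mat m
    relabel f = (P ⊗ diagonal (f ∘ diag D)) ⊗ P⁻¹

    P⁻¹≡0⇒≡0 : ∀ {v} → P⁻¹ ·v v ≡ 0v → v ≡ 0v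
    P⁻¹≡0⇒≡0 {v} P⁻¹v≡0 = trans (sym (·v-inverse PP⁻¹≡I v)) (trans (cong (P ·v_) P⁻¹v≡0) (·v-0v P))

    Eigenspace-conj : ∀ A μ → Eigenspace ((P ⊗ A) ⊗ P⁻¹) μ ≐ (λ v → Eigenspace A μ (P⁻¹ ·v v))
    Eigenspace-conj A μ = to , from
      where
      conj-·v : ∀ v → ((P ⊗ A) ⊗ P⁻¹) ·v v ≡ P ·v (A ·v (P⁻¹ ·v v))
      conj-·v v = trans (⊗-·v (P ⊗ A) P⁻¹ v) (⊗-·v P A (P⁻¹ ·v v))

      to : Eigenspace ((P ⊗ A) ⊗ P⁻¹) μ ⊆ (λ v → Eigenspace A μ (P⁻¹ ·v v))
      to {v} v∈E = begin
        A ·v (P⁻¹ ·v v)                     ≡⟨ ·v-inverse P⁻¹P≡I _ ⟨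
        P⁻¹ ·v (P ·v (A ·v (P⁻¹ ·v v)))     ≡⟨ cong (P⁻¹ ·v_) (conj-·v v) ⟨
        P⁻¹ ·v (((P ⊗ A) ⊗ P⁻¹) ·v v)       ≡⟨ cong (P⁻¹ ·v_) v∈E ⟩
        P⁻¹ ·v scale μ v                    ≡⟨ ·v-scale P⁻¹ μ v ⟩
        scale μ (P⁻¹ ·v v)                  ∎

      from : (λ v → Eigenspace A μ (P⁻¹ ·v v)) ⊆ Eigenspace ((P ⊗ A) ⊗ P⁻¹) μ
      from {v} P⁻¹v∈E = begin
        ((P ⊗ A) ⊗ P⁻¹) ·v v                ≡⟨ conj-·v v ⟩
        P ·v (A ·v (P⁻¹ ·v v))              ≡⟨ cong (P ·v_) P⁻¹v∈E ⟩
        P ·v scale μ (P⁻¹ ·v v)             ≡⟨ ·v-scale P μ _ ⟩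
        scale μ (P ·v (P⁻¹ ·v v))           ≡⟨ cong (scale μ) (·v-inverse PP⁻¹≡I v) ⟩
        scale μ v                           ∎

    Eigenspace-coordinates : ∀ μ → Eigenspace M μ ≐ (λ v → Supported (diag D) μ (P⁻¹ ·v v))
    Eigenspace-coordinates μ with Eigenspace-conj D μ | Eigenspace-isDiagonal D D-diagonal μ
    ... | to , from | to′ , from′ = (λ v∈E → to′ (to v∈E)) , (λ x∈S → from (from′ x∈S))

    Eigenspace-relabel-coordinates : ∀ f μ →
                                     Eigenspace (relabel f) μ ≐ (λ v → Supported (f ∘ diag D) μ (P⁻¹ ·v v))
    Eigenspace-relabel-coordinates f μ
      with Eigenspace-conj (diagonal (f ∘ diag D)) μ | Eigenspace-diagonal (f ∘ diag D) μ
    ... | to , from | to′ , from′ = (λ v∈E → to′ (to v∈E)) , (λ x∈S → from (from′ x∈S))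

    Eigenspace-relabel : ∀ f {μ} → Eigenspace M μ ⊆ Eigenspace (relabel f) (f μ)
    Eigenspace-relabel f {μ} {v} v∈E = proj₂ (Eigenspace-relabel-coordinates f (f μ))
      (Supported-map f {x = P⁻¹ ·v v} (proj₁ (Eigenspace-coordinates μ) v∈E))

    Eigenspace-relabel-reflect : ∀ {f μ} → (∀ a → f a ≡ μ → a ≡ μ) →
                                 Eigenspace (relabel f) μ ⊆ Eigenspace M μ
    Eigenspace-relabel-reflect {f} {μ} f-reflects {v} v∈E = proj₂ (Eigenspace-coordinates μ)
      (Supported-reflect f-reflects {x = P⁻¹ ·v v} (proj₁ (Eigenspace-relabel-coordinates f μ) v∈E))

    Eigenspace-relabel-≢⇒≡0v : ∀ {f μ v} → (∀ a → f a ≢ μ) → Eigenspace (relabel f) μ v → v ≡ 0v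
    Eigenspace-relabel-≢⇒≡0v {f} {μ} f≢μ v∈E =
      P⁻¹≡0⇒≡0 (Supported-≢⇒≡0v (f≢μ ∘ diag D) (proj₁ (Eigenspace-relabel-coordinates f μ) v∈E))

    Eigenspace-independent : ∀ {a b} → a ≢ b → Independent (Eigenspace M a) (Eigenspace M b)
    Eigenspace-independent {a} {b} a≢b {u} {w} u∈E w∈E u+w≡0
      with Supported-independent a≢b (proj₁ (Eigenspace-coordinates a) u∈E)
                                     (proj₁ (Eigenspace-coordinates b) w∈E) (begin
        (P⁻¹ ·v u) +v (P⁻¹ ·v w) ≡⟨ ·v-+v P⁻¹ u w ⟨
        P⁻¹ ·v (u +v w)          ≡⟨ cong (P⁻¹ ·v_) u+w≡0 ⟩
        P⁻¹ ·v 0v                ≡⟨ ·v-0v P⁻¹ ⟩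
        0v                       ∎)
    ... | P⁻¹u≡0 , P⁻¹w≡0 = P⁻¹≡0⇒≡0 P⁻¹u≡0 , P⁻¹≡0⇒≡0 P⁻¹w≡0

    Eigenspace-+v⇒≡ : ∀ {a b μ u w} → a ≢ b → Eigenspace M a u → Eigenspace M b w → u ≢ 0v →
                    Eigenspace M μ (u +v w) → μ ≡ a
    Eigenspace-+v⇒≡ {a} {b} {μ} {u} {w} a≢b u∈E w∈E u≢0 u+w∈E =
      Supported-+v⇒≡ a≢b (proj₁ (Eigenspace-coordinates a) u∈E) (proj₁ (Eigenspace-coordinates b) w∈E)
        (u≢0 ∘ P⁻¹≡0⇒≡0)
        (subst (Supported (diag D) μ) (·v-+v P⁻¹ u w) (proj₁ (Eigenspace-coordinates μ) u+w∈E))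

    Eigenspace-merge : ∀ {a b} → a ≢ b →
                       Eigenspace (relabel (replace b a)) a ≐ Eigenspace M a +ₛ Eigenspace M b
    Eigenspace-merge {a} {b} a≢b = to , from
      where
      M′ = relabel (replace b a)

      to : Eigenspace (relabel (replace b a)) a ⊆ Eigenspace M a +ₛ Eigenspace M b
      to {v} v∈E
        with Supported-replace {x = P⁻¹ ·v v} (proj₁ (Eigenspace-relabel-coordinates (replace b a) a) v∈E)
      ... | x₁ , x₂ , x₁∈S , x₂∈S , P⁻¹v≡x₁+x₂ =
        P ·v x₁ , P ·v x₂ , back a x₁∈S , back b x₂∈S , (begin
          v                        ≡⟨ ·v-inverse PP⁻¹≡I v ⟨
          P ·v (P⁻¹ ·v v)          ≡⟨ cong (P ·v_) P⁻¹v≡x₁+x₂ ⟩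
          P ·v (x₁ +v x₂)          ≡⟨ ·v-+v P x₁ x₂ ⟩
          (P ·v x₁) +v (P ·v x₂)   ∎)
        where
        back : ∀ μ {x} → Supported (diag D) μ x → Eigenspace M μ (P ·v x)
        back μ {x} x∈S =
          proj₂ (Eigenspace-coordinates μ) (subst (Supported (diag D) μ) (sym (·v-inverse P⁻¹P≡I x)) x∈S)

      from : Eigenspace M a +ₛ Eigenspace M b ⊆ Eigenspace (relabel (replace b a)) a
      from (u₁ , u₂ , u₁∈E , u₂∈E , refl) = +v-closed (Eigenspace-isSubspace M′ a)
        (subst (λ μ → Eigenspace M′ μ u₁) (replace-fixed a a≢b) (Eigenspace-relabel (replace b a) u₁∈E))
        (subst (λ μ → Eigenspace M′ μ u₂) (replace-target b a) (Eigenspace-relabel (replace b a) u₂∈E))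

    ν-merge : ∀ {a b} → a ≢ b → IsEigenvalue M a → IsEigenvalue M b → ν M < ν (relabel (replace b a))
    ν-merge {a} {b} a≢b (u , u≢0 , u∈E) (w , w≢0 , w∈E) =
      filter-length-< (isEigenvector? M) (isEigenvector? _) eigenvector-relabel (∈-allVecs (u +v w))
        (IsEigenvector-intro u+w≢0 (proj₂ (Eigenspace-merge a≢b) (u , w , u∈E , w∈E , refl)))
        u+w-not-eigenvector
      where
      eigenvector-relabel : IsEigenvector M ⊆ IsEigenvector (relabel (replace b a))
      eigenvector-relabel v-eigen@(v≢0 , _) with IsEigenvector-elim v-eigen
      ... | μ , v∈E = IsEigenvector-intro v≢0 (Eigenspace-relabel (replace b a) v∈E)

      u+w≢0 : u +v w ≢ 0v
      u+w≢0 = u≢0 ∘ proj₁ ∘ Eigenspace-independent a≢b u∈E w∈E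

      u+w-not-eigenvector : ¬ IsEigenvector M (u +v w)
      u+w-not-eigenvector u+w-eigen with IsEigenvector-elim u+w-eigen
      ... | μ , u+w∈E = a≢b (trans (sym μ≡a) μ≡b)
        where
        μ≡a : μ ≡ a
        μ≡a = Eigenspace-+v⇒≡ a≢b u∈E w∈E u≢0 u+w∈E
        μ≡b : μ ≡ b
        μ≡b = Eigenspace-+v⇒≡ (a≢b ∘ sym) w∈E u∈E w≢0 (subst (Eigenspace M μ) (+v-comm u w) u+w∈E)

  module MergeTop {m s} {P P⁻¹ D : Mat m} (PP⁻¹≡I : P ⊗ P⁻¹ ≡ identity) (P⁻¹P≡I : P⁻¹ ⊗ P ≡ identity)
                  (D-diagonal : IsDiagonal D) {λ₁ λ₂ : Carrier} {λs : Vec Carrier s}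
                  (distinct : Distinct (λ₁ ∷ λ₂ ∷ λs)) where
    open Diagonalized {D = D} PP⁻¹≡I P⁻¹P≡I D-diagonal public

    λ₁≢λ₂ : λ₁ ≢ λ₂
    λ₁≢λ₂ = 0≢1+n ∘ distinct zero (suc zero)

    λs≢λ₁ : ∀ i → lookup λs i ≢ λ₁
    λs≢λ₁ i = 0≢1+n ∘ sym ∘ distinct (suc (suc i)) zero

    λs≢λ₂ : ∀ i → lookup λs i ≢ λ₂
    λs≢λ₂ i = 0≢1+n ∘ suc-injective ∘ sym ∘ distinct (suc (suc i)) (suc zero)

    M′ : Mat m
    M′ = relabel (replace λ₂ λ₁)

    M′-diagonalizable : Diagonalizable M′
    M′-diagonalizable =
      P , P⁻¹ , diagonal (replace λ₂ λ₁ ∘ diag D) , PP⁻¹≡I , P⁻¹P≡I , diagonal-isDiagonal _ , refl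

    Eigenspace-M′-unmoved : ∀ {μ} → μ ≢ λ₁ → μ ≢ λ₂ → Eigenspace M′ μ ≐ Eigenspace M μ
    Eigenspace-M′-unmoved {μ} μ≢λ₁ μ≢λ₂ =
      Eigenspace-relabel-reflect (replace-reflects μ≢λ₁) ,
      λ {v} v∈E → subst (λ μ′ → Eigenspace M′ μ′ v) (replace-fixed λ₁ μ≢λ₂)
                        (Eigenspace-relabel (replace λ₂ λ₁) v∈E)

    eigenvalues-M′ : (∀ i → IsEigenvalue M (lookup (λ₁ ∷ λ₂ ∷ λs) i)) →
                     ∀ i → IsEigenvalue M′ (lookup (λ₁ ∷ λs) i)
    eigenvalues-M′ eigenvalue zero with eigenvalue zero
    ... | v , v≢0 , v∈E = v , v≢0 , proj₂ (Eigenspace-merge λ₁≢λ₂) (+ₛ-inˡ (Eigenspace-isSubspace M λ₂) v∈E)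
    eigenvalues-M′ eigenvalue (suc i) with eigenvalue (suc (suc i))
    ... | v , v≢0 , v∈E = v , v≢0 , proj₂ (Eigenspace-M′-unmoved (λs≢λ₁ i) (λs≢λ₂ i)) v∈E

    eigenvalues-M′-complete : (∀ μ → IsEigenvalue M μ → ∃[ i ] (μ ≡ lookup (λ₁ ∷ λ₂ ∷ λs) i)) →
                              ∀ μ → IsEigenvalue M′ μ → ∃[ i ] (μ ≡ lookup (λ₁ ∷ λs) i)
    eigenvalues-M′-complete complete μ (v , v≢0 , v∈E) with μ ≟ λ₁ | μ ≟ λ₂
    ... | yes μ≡λ₁ | _        = zero , μ≡λ₁
    ... | no _     | yes refl = ⊥-elim (v≢0 (Eigenspace-relabel-≢⇒≡0v (replace-≢ λ₁≢λ₂) v∈E))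
    ... | no μ≢λ₁  | no μ≢λ₂ with complete μ (v , v≢0 , proj₁ (Eigenspace-M′-unmoved μ≢λ₁ μ≢λ₂) v∈E)
    ...   | zero        , μ≡λ₁  = ⊥-elim (μ≢λ₁ μ≡λ₁)
    ...   | suc zero    , μ≡λ₂  = ⊥-elim (μ≢λ₂ μ≡λ₂)
    ...   | suc (suc i) , μ≡λsᵢ = suc i , μ≡λsᵢ

    dimensions-M′ : ∀ {g₁ g₂} {gs : Vec ℕ s} →
                    (∀ i → HasDimension (Eigenspace M (lookup (λ₁ ∷ λ₂ ∷ λs) i)) (lookup (g₁ ∷ g₂ ∷ gs) i)) →
                    ∀ i → HasDimension (Eigenspace M′ (lookup (λ₁ ∷ λs) i)) (lookup (mergeTop (g₁ ∷ g₂ ∷ gs)) i)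
    dimensions-M′ dims zero =
      HasDimension-resp (≐-sym (Eigenspace-merge λ₁≢λ₂))
        (HasDimension-+ₛ (Eigenspace-isSubspace M λ₁) (Eigenspace-isSubspace M λ₂)
                         (Eigenspace-independent λ₁≢λ₂) (dims zero) (dims (suc zero)))
    dimensions-M′ dims (suc i) =
      HasDimension-resp (≐-sym (Eigenspace-M′-unmoved (λs≢λ₁ i) (λs≢λ₂ i))) (dims (suc (suc i)))

-- Any two distinct eigenvalues can be merged this way.
lemma3p7 : ∀ {q : ℕ} (F : FiniteField q) (n s : ℕ)
             (M : LinAlg.Mat F (suc n)) (g : Vec ℕ (suc (suc s))) →
             1 ≤ s →
             LinAlg.Diagonalizable F M →
             LinAlg.EigenspaceDims F M g →
             Descending g →
             Σ (LinAlg.Mat F (suc n)) (λ M' →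
               LinAlg.Diagonalizable F M' ×
               LinAlg.EigenspaceDims F M' (mergeTop g) ×
               LinAlg.ν F M < LinAlg.ν F M')
lemma3p7 F n s _ (g₁ ∷ g₂ ∷ gs) _ (P , P⁻¹ , D , PP⁻¹≡I , P⁻¹P≡I , D-diagonal , refl)
         (λ₁ ∷ λ₂ ∷ λs , distinct , eigenvalue , complete , dims) _ =
  M′ , M′-diagonalizable
     , (λ₁ ∷ λs , Distinct-drop-second distinct , eigenvalues-M′ eigenvalue
                , eigenvalues-M′-complete complete , dimensions-M′ dims)
     , ν-merge λ₁≢λ₂ (eigenvalue zero) (eigenvalue (suc zero))
  where open MergeTop F {D = D} PP⁻¹≡I P⁻¹P≡I D-diagonal distinct
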